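{- Let $(R,\triangleright)$ be a finite rack. Then: (1) The intersection of all maximal subracks of $R$ is empty. (2) For any two subracks $Q_1$ and $Q_2$ of $R$, letting $T=\ll Q_1,Q_2\gg$ be the subrack of $R$ generated by $Q_1\cup Q_2$, the subrack $Q_1$ has a complement in the lattice $\mathcal{R}(T)$ of subracks of $T$ which is a subset of $Q_2$; that is, there is a subrack $Q\subseteq Q_2$ with $Q_1\cap Q=\emptyset$ and $\ll Q_1, Q\gg = T$.
   Context: A rack is a set $R$ with a binary operation $\triangleright$ such that $a\triangleright(b\triangleright c)=(a\triangleright b)\triangleright(a\triangleright c)$ for all $a,b,c\in R$, and for all $a,b\in R$ there is a unique $x\in R$ with $a\triangleright x=b$. A subrack of $R$ is a subset $Q\subseteq R$ such that $(Q,\triangleright)$ is itself a rack (the empty set is a subrack). For $S\subseteq R$, $\ll S\gg$ denotes the intersection of all subracks of $R$ containing $S$. The set $\mathcal{R}(R)$ of all subracks of $R$, ordered by inclusion, is a lattice with meet the intersection and join $Q\vee Q'=\ll Q\cup Q'\gg$; its least element is $\emptyset$ and greatest element is $R$. A complement of $Q$ in $\mathcal{R}(T)$ is a subrack $Q'$ of $T$ with $Q\cap Q'=\emptyset$ and $\ll Q\cup Q'\gg=T$. A maximal subrack of $R$ is a proper subrack of $R$ maximal under inclusion among proper subracks; the intersection of the empty family of subsets of $R$ is taken to be $R$. -}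

module Defs where

open import Data.Nat using (ℕ)
open import Data.Fin using (Fin)
open import Data.Fin.Subset using (Subset; _∈_; _∉_; _⊆_; _∪_)
open import Data.Product using (Σ; _×_; ∃)
open import Relation.Binary.PropositionalEquality using (_≡_)
open import Relation.Nullary using (¬_)

-- A finite rack: carrier Fin n (any finite set, up to bijection).
record Rack (n : ℕ) : Set where
  field
    _▷_      : Fin n → Fin n → Fin n
    selfdist : ∀ a b c → a ▷ (b ▷ c) ≡ (a ▷ b) ▷ (a ▷ c)
    uniqueSol : ∀ a b → Σ (Fin n) λ x → (a ▷ x ≡ b) × (∀ y → a ▷ y ≡ b → x ≡ y)

module _ {n : ℕ} (R : Rack n) where
  open Rack R

  -- Q ⊆ R is a subrack: (Q, ▷) is a rack, i.e. ▷ restricts to Q and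
  -- for a, b ∈ Q there is a unique x ∈ Q with a ▷ x = b
  -- (self-distributivity is inherited from R).
  IsSubrack : Subset n → Set
  IsSubrack Q =
    (∀ a b → a ∈ Q → b ∈ Q → (a ▷ b) ∈ Q) ×
    (∀ a b → a ∈ Q → b ∈ Q →
       Σ (Fin n) λ x → x ∈ Q × (a ▷ x ≡ b) × (∀ y → y ∈ Q → a ▷ y ≡ b → x ≡ y))

  _∈≪_≫ : Fin n → Subset n → Set
  x ∈≪ S ≫ = ∀ Q → IsSubrack Q → S ⊆ Q → x ∈ Q

  IsMaximalSubrack : Subset n → Set
  IsMaximalSubrack M =
    IsSubrack M × (∃ λ x → x ∉ M) ×
    (∀ Q → IsSubrack Q → M ⊆ Q → (∃ λ x → x ∉ Q) → Q ⊆ M)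

  -- membership in the intersection of all maximal subracks
  -- (equal to R if there are none)
  _∈⋂Max : Fin n → Set
  x ∈⋂Max = ∀ M → IsMaximalSubrack M → x ∈ M

module Submission where

-- We work inside any subrack U.
-- (1) Left multiplications by elements of U are automorphisms stabilising U;
-- they permute the maximal subracks of U, so Φ(U) is invariant and U ∖ Φ(U)
-- is a subrack.  If Φ(U) met U, U ∖ Φ(U) would be proper, hence (finiteness)
-- inside a maximal M ⊇ Φ(U), forcing M = U.  So every x ∈ U is avoided by a
-- maximal subrack of U.
-- (2) Start with Q = Q₂ and the invariant Q₂ ⊆ ≪ Q₁ ∪ Q ≫.  While some x lies
-- in Q₁ ∩ Q, pass to a maximal subrack M of Q avoiding x; maximality gives
-- Q ⊆ ≪ x , M ≫, so the invariant survives, and Q strictly shrinks.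
-- Subracks are handled as subsets closed under ▷ and left division (a
-- decidable condition); finiteness enters through quantification over all
-- subsets and the well-foundedness of ⊂ and ⊃.

open import Defs
open import Data.Nat using (ℕ)
open import Data.Fin using (Fin)
open import Data.Fin.Subset using (Subset; _∈_; _∉_; _⊆_; _⊂_; _⊃_; _∪_; _∩_; ⊤)
open import Data.Fin.Subset.Properties
  using (_∈?_; _⊆?_; _⊂?_; anySubset?; ∈⊤; x∈p∪q⁺; x∈p∪q⁻; x∈p∩q⁺; x∈p∩q⁻)
open import Data.Fin.Subset.Induction using (⊂-wellFounded; ⊃-wellFounded)
open import Data.Fin.Properties using (any?; all?)
open import Data.Vec using (tabulate)
open import Data.Vec.Properties using (lookup∘tabulate; []=⇒lookup; lookup⇒[]=)
open import Data.Product using (Σ; _×_; _,_; proj₁; proj₂; ∃)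
open import Data.Sum using (inj₁; inj₂)
open import Data.Bool using (true)
open import Data.Empty using (⊥; ⊥-elim)
open import Function using (_∘_)
open import Induction.WellFounded using (Acc; acc)
open import Relation.Nullary using (¬_; Dec; yes; no; does; ¬?; _×-dec_; _→-dec_)
open import Relation.Nullary.Decidable using (map′; dec-true; decidable-stable)
open import Relation.Unary using (Decidable)
open import Relation.Binary.PropositionalEquality
  using (_≡_; refl; sym; trans; cong; cong₂; subst)
open Relation.Binary.PropositionalEquality.≡-Reasoning

module FiniteSubsets {n : ℕ} where

  ⟦_⟧ : {P : Fin n → Set} → Decidable P → Subset n
  ⟦ P? ⟧ = tabulate (λ x → does (P? x))

  ∈⟦⟧⁺ : ∀ {P : Fin n → Set} (P? : Decidable P) {x} → P x → x ∈ ⟦ P? ⟧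
  ∈⟦⟧⁺ P? {x} px = lookup⇒[]= x _ (trans (lookup∘tabulate _ x) (dec-true (P? x) px))

  ∈⟦⟧⁻ : ∀ {P : Fin n → Set} (P? : Decidable P) {x} → x ∈ ⟦ P? ⟧ → P x
  ∈⟦⟧⁻ P? {x} x∈ = witness (P? x) (trans (sym (lookup∘tabulate _ x)) ([]=⇒lookup x∈))
    where
    witness : ∀ {A : Set} (a? : Dec A) → does a? ≡ true → A
    witness (yes a) _ = a
    witness (no _) ()

  allSubset? : {P : Subset n → Set} → Decidable P → Dec (∀ S → P S)
  allSubset? P? = map′ (λ noCounterexample S → decidable-stable (P? S) (λ ¬PS → noCounterexample (S , ¬PS)))
                       (λ allP (S , ¬PS) → ¬PS (allP S))
                       (¬? (anySubset? (λ S → ¬? (P? S))))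

  ⊆-not-⊂ : ∀ {X N : Subset n} → X ⊆ N → ¬ (X ⊂ N) → N ⊆ X
  ⊆-not-⊂ {X} X⊆N X⊄N {z} z∈N with z ∈? X
  ... | yes z∈X = z∈X
  ... | no z∉X = ⊥-elim (X⊄N (X⊆N , z , z∈N , z∉X))

  Maximal : (Subset n → Set) → Subset n → Set
  Maximal P M = P M × (∀ N → P N → M ⊆ N → N ⊆ M)

  maximal? : {P : Subset n → Set} → Decidable P → Decidable (Maximal P)
  maximal? P? M = P? M ×-dec allSubset? (λ N → P? N →-dec ((M ⊆? N) →-dec (N ⊆? M)))

  maximal-above : {P : Subset n → Set} → Decidable P → ∀ {X} → P X →
                  Σ (Subset n) λ M → Maximal P M × X ⊆ M
  maximal-above {P} P? {X} PX = go X (⊃-wellFounded X) PX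
    where
    go : ∀ X → Acc _⊃_ X → P X → Σ (Subset n) λ M → Maximal P M × X ⊆ M
    go X (acc larger) PX with anySubset? (λ N → P? N ×-dec (X ⊂? N))
    ... | yes (N , PN , X⊂N) with go N (larger X⊂N) PN
    ...   | M , maxM , N⊆M = M , maxM , N⊆M ∘ proj₁ X⊂N
    go X (acc larger) PX | no noLarger =
      X , (PX , λ N PN X⊆N → ⊆-not-⊂ X⊆N (λ X⊂N → noLarger (N , PN , X⊂N))) , λ x∈X → x∈X

module RackTheory {n : ℕ} (R : Rack n) where
  open Rack R
  open FiniteSubsets

  inv : Fin n → Fin n → Fin n
  inv a b = proj₁ (uniqueSol a b)

  ▷-inv : ∀ a b → a ▷ inv a b ≡ b
  ▷-inv a b = proj₁ (proj₂ (uniqueSol a b))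

  inv-unique : ∀ {a b y} → a ▷ y ≡ b → inv a b ≡ y
  inv-unique {a} {b} {y} = proj₂ (proj₂ (uniqueSol a b)) y

  inv-▷ : ∀ a y → inv a (a ▷ y) ≡ y
  inv-▷ a y = inv-unique refl

  -- The decidable description of subracks: closed under ▷ and left division.
  Closed : Subset n → Set
  Closed Q = (∀ a b → a ∈ Q → b ∈ Q → (a ▷ b) ∈ Q) ×
             (∀ a b → a ∈ Q → b ∈ Q → inv a b ∈ Q)

  closed? : Decidable Closed
  closed? Q = (all? λ a → all? λ b → (a ∈? Q) →-dec ((b ∈? Q) →-dec ((a ▷ b) ∈? Q)))
        ×-dec (all? λ a → all? λ b → (a ∈? Q) →-dec ((b ∈? Q) →-dec (inv a b ∈? Q)))

  closed⇒subrack : ∀ {Q} → Closed Q → IsSubrack R Q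
  closed⇒subrack (▷-cl , inv-cl) =
    ▷-cl , λ a b a∈Q b∈Q → inv a b , inv-cl a b a∈Q b∈Q , ▷-inv a b , λ y _ e → inv-unique e

  subrack⇒closed : ∀ {Q} → IsSubrack R Q → Closed Q
  subrack⇒closed {Q} (▷-cl , solvable) = ▷-cl , λ a b a∈Q b∈Q → solution∈Q (solvable a b a∈Q b∈Q)
    where
    solution∈Q : ∀ {a b} → Σ (Fin n) (λ x → x ∈ Q × (a ▷ x ≡ b) × (∀ y → y ∈ Q → a ▷ y ≡ b → x ≡ y)) →
                 inv a b ∈ Q
    solution∈Q (x , x∈Q , e , _) = subst (_∈ Q) (sym (inv-unique e)) x∈Q

  ∩-closed : ∀ {A B} → Closed A → Closed B → Closed (A ∩ B)
  ∩-closed {A} {B} (▷A , invA) (▷B , invB) =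
    (λ a b a∈ b∈ → both ▷A ▷B a b a∈ b∈) , (λ a b a∈ b∈ → both invA invB a b a∈ b∈)
    where
    both : ∀ {f : Fin n → Fin n → Fin n} →
           (∀ a b → a ∈ A → b ∈ A → f a b ∈ A) → (∀ a b → a ∈ B → b ∈ B → f a b ∈ B) →
           ∀ a b → a ∈ A ∩ B → b ∈ A ∩ B → f a b ∈ A ∩ B
    both clA clB a b a∈ b∈ with x∈p∩q⁻ A B a∈ | x∈p∩q⁻ A B b∈
    ... | a∈A , a∈B | b∈A , b∈B = x∈p∩q⁺ (clA a b a∈A b∈A , clB a b a∈B b∈B)

  Proper : Subset n → Subset n → Set
  Proper U N = ∃ λ x → x ∈ U × x ∉ N

  ProperSubrack : Subset n → Subset n → Set
  ProperSubrack U N = Closed N × N ⊆ U × Proper U N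

  properSubrack? : ∀ U → Decidable (ProperSubrack U)
  properSubrack? U N = closed? N ×-dec ((N ⊆? U) ×-dec any? (λ x → (x ∈? U) ×-dec ¬? (x ∈? N)))

  MaximalIn : Subset n → Subset n → Set
  MaximalIn U = Maximal (ProperSubrack U)

  record Automorphism (U : Subset n) : Set where
    field
      to from : Fin n → Fin n
      to-from : ∀ z → to (from z) ≡ z
      from-to : ∀ z → from (to z) ≡ z
      to-hom  : ∀ z w → to (z ▷ w) ≡ to z ▷ to w
      to-U    : ∀ {z} → z ∈ U → to z ∈ U
      from-U  : ∀ {z} → z ∈ U → from z ∈ U

    from-hom : ∀ z w → from (z ▷ w) ≡ from z ▷ from w
    from-hom z w = begin
      from (z ▷ w)                 ≡⟨ cong from (cong₂ _▷_ (sym (to-from z)) (sym (to-from w))) ⟩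
      from (to (from z) ▷ to (from w)) ≡⟨ cong from (sym (to-hom (from z) (from w))) ⟩
      from (to (from z ▷ from w))  ≡⟨ from-to (from z ▷ from w) ⟩
      from z ▷ from w              ∎

    to-inv : ∀ z w → to (inv z w) ≡ inv (to z) (to w)
    to-inv z w = sym (inv-unique (trans (sym (to-hom z (inv z w))) (cong to (▷-inv z w))))

  open Automorphism

  inverse : ∀ {U} → Automorphism U → Automorphism U
  inverse φ = record
    { to = from φ ; from = to φ ; to-from = from-to φ ; from-to = to-from φ
    ; to-hom = from-hom φ ; to-U = from-U φ ; from-U = to-U φ }

  leftMul : ∀ {U} → Closed U → ∀ {a} → a ∈ U → Automorphism U
  leftMul (▷U , invU) {a} a∈U = record
    { to = a ▷_ ; from = inv a ; to-from = ▷-inv a ; from-to = inv-▷ a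
    ; to-hom = selfdist a ; to-U = ▷U a _ a∈U ; from-U = invU a _ a∈U }

  preimage : ∀ {U} → Automorphism U → Subset n → Subset n
  preimage φ M = ⟦ (λ z → to φ z ∈? M) ⟧

  ∈preimage⁺ : ∀ {U M z} (φ : Automorphism U) → to φ z ∈ M → z ∈ preimage φ M
  ∈preimage⁺ {M = M} φ = ∈⟦⟧⁺ (λ z → to φ z ∈? M)

  ∈preimage⁻ : ∀ {U M z} (φ : Automorphism U) → z ∈ preimage φ M → to φ z ∈ M
  ∈preimage⁻ {M = M} φ = ∈⟦⟧⁻ (λ z → to φ z ∈? M)

  preimage-properSubrack : ∀ {U M} (φ : Automorphism U) → ProperSubrack U M →
                           ProperSubrack U (preimage φ M)
  preimage-properSubrack {U} {M} φ ((▷M , invM) , M⊆U , (x , x∈U , x∉M)) =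
    (▷pre , invpre) , pre⊆U , from φ x , from-U φ x∈U ,
    λ fx∈pre → x∉M (subst (_∈ M) (to-from φ x) (∈preimage⁻ φ fx∈pre))
    where
    ▷pre : ∀ a b → a ∈ preimage φ M → b ∈ preimage φ M → (a ▷ b) ∈ preimage φ M
    ▷pre a b a∈ b∈ = ∈preimage⁺ φ (subst (_∈ M) (sym (to-hom φ a b)) (▷M _ _ (∈preimage⁻ φ a∈) (∈preimage⁻ φ b∈)))
    invpre : ∀ a b → a ∈ preimage φ M → b ∈ preimage φ M → inv a b ∈ preimage φ M
    invpre a b a∈ b∈ = ∈preimage⁺ φ (subst (_∈ M) (sym (to-inv φ a b)) (invM _ _ (∈preimage⁻ φ a∈) (∈preimage⁻ φ b∈)))
    pre⊆U : preimage φ M ⊆ U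
    pre⊆U {z} z∈ = subst (_∈ U) (from-to φ z) (from-U φ (M⊆U (∈preimage⁻ φ z∈)))

  preimage-maximal : ∀ {U M} (φ : Automorphism U) → MaximalIn U M → MaximalIn U (preimage φ M)
  preimage-maximal {U} {M} φ (properM , maxM) = preimage-properSubrack φ properM , max
    where
    φ⁻¹ : Automorphism U
    φ⁻¹ = inverse φ
    max : ∀ N → ProperSubrack U N → preimage φ M ⊆ N → N ⊆ preimage φ M
    max N properN pre⊆N {z} z∈N = ∈preimage⁺ φ (N'⊆M (∈preimage⁺ φ⁻¹ fz∈N))
      where
      fz∈N : from φ (to φ z) ∈ N
      fz∈N = subst (_∈ N) (sym (from-to φ z)) z∈N
      M⊆N' : M ⊆ preimage φ⁻¹ N
      M⊆N' {m} m∈M = ∈preimage⁺ φ⁻¹ (pre⊆N (∈preimage⁺ φ (subst (_∈ M) (sym (to-from φ m)) m∈M)))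
      N'⊆M : preimage φ⁻¹ N ⊆ M
      N'⊆M = maxM (preimage φ⁻¹ N) (preimage-properSubrack φ⁻¹ properN) M⊆N'

  InFrattini : Subset n → Fin n → Set
  InFrattini U x = ∀ M → MaximalIn U M → x ∈ M

  inFrattini? : ∀ U → Decidable (InFrattini U)
  inFrattini? U x = allSubset? (λ M → maximal? (properSubrack? U) M →-dec (x ∈? M))

  frattini-invariant : ∀ {U x} (φ : Automorphism U) → InFrattini U x → InFrattini U (to φ x)
  frattini-invariant φ x∈Φ M maxM = ∈preimage⁻ φ (x∈Φ (preimage φ M) (preimage-maximal φ maxM))

  nonFrattini? : ∀ U → Decidable (λ z → z ∈ U × ¬ InFrattini U z)
  nonFrattini? U z = (z ∈? U) ×-dec ¬? (inFrattini? U z)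

  NonFrattini : Subset n → Subset n
  NonFrattini U = ⟦ nonFrattini? U ⟧

  ∈nonFrattini⁺ : ∀ {U z} → z ∈ U → ¬ InFrattini U z → z ∈ NonFrattini U
  ∈nonFrattini⁺ {U} z∈U z∉Φ = ∈⟦⟧⁺ (nonFrattini? U) (z∈U , z∉Φ)

  ∈nonFrattini⁻ : ∀ {U z} → z ∈ NonFrattini U → z ∈ U × ¬ InFrattini U z
  ∈nonFrattini⁻ {U} = ∈⟦⟧⁻ (nonFrattini? U)

  nonFrattini-closed : ∀ {U} → Closed U → Closed (NonFrattini U)
  nonFrattini-closed {U} closedU@(▷U , invU) = ▷W , invW
    where
    ▷W : ∀ a b → a ∈ NonFrattini U → b ∈ NonFrattini U → (a ▷ b) ∈ NonFrattini U
    ▷W a b a∈ b∈ with ∈nonFrattini⁻ a∈ | ∈nonFrattini⁻ b∈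
    ... | a∈U , _ | b∈U , b∉Φ = ∈nonFrattini⁺ (▷U a b a∈U b∈U) λ ab∈Φ → b∉Φ (subst (InFrattini U) (inv-▷ a b)
            (frattini-invariant (inverse (leftMul closedU a∈U)) ab∈Φ))
    invW : ∀ a b → a ∈ NonFrattini U → b ∈ NonFrattini U → inv a b ∈ NonFrattini U
    invW a b a∈ b∈ with ∈nonFrattini⁻ a∈ | ∈nonFrattini⁻ b∈
    ... | a∈U , _ | b∈U , b∉Φ = ∈nonFrattini⁺ (invU a b a∈U b∈U) λ ab∈Φ → b∉Φ (subst (InFrattini U) (▷-inv a b)
            (frattini-invariant (leftMul closedU a∈U) ab∈Φ))

  frattini-empty : ∀ {U x} → Closed U → x ∈ U → ¬ InFrattini U x
  frattini-empty {U} {x} closedU x∈U x∈Φ with maximal-above (properSubrack? U) properW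
    where
    properW : ProperSubrack U (NonFrattini U)
    properW = nonFrattini-closed closedU , proj₁ ∘ ∈nonFrattini⁻ , x , x∈U , λ x∈W → proj₂ (∈nonFrattini⁻ x∈W) x∈Φ
  ... | M , maxM@((_ , _ , y , y∈U , y∉M) , _) , W⊆M with inFrattini? U y
  ...   | yes y∈Φ = y∉M (y∈Φ M maxM)
  ...   | no y∉Φ = y∉M (W⊆M (∈nonFrattini⁺ y∈U y∉Φ))

  avoiding-maximal : ∀ {U x} → Closed U → x ∈ U → Σ (Subset n) λ M → MaximalIn U M × x ∉ M
  avoiding-maximal {U} {x} closedU x∈U
    with anySubset? (λ M → maximal? (properSubrack? U) M ×-dec ¬? (x ∈? M))
  ... | yes (M , maxM , x∉M) = M , maxM , x∉M
  ... | no none = ⊥-elim (frattini-empty closedU x∈U λ M maxM →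
                    decidable-stable (x ∈? M) (λ x∉M → none (M , maxM , x∉M)))

  maximalIn⊤⇒maximal : ∀ {M} → MaximalIn ⊤ M → IsMaximalSubrack R M
  maximalIn⊤⇒maximal ((closedM , _ , y , _ , y∉M) , maxM) =
    closed⇒subrack closedM , (y , y∉M) ,
    λ Q subQ M⊆Q (z , z∉Q) → maxM Q (subrack⇒closed subQ , (λ _ → ∈⊤) , z , ∈⊤ , z∉Q) M⊆Q

  ⋂maximal-empty : ∀ x → ¬ (_∈⋂Max R x)
  ⋂maximal-empty x x∈⋂ with avoiding-maximal {⊤} ((λ _ _ _ _ → ∈⊤) , (λ _ _ _ _ → ∈⊤)) ∈⊤
  ... | M , maxM , x∉M = x∉M (x∈⋂ M (maximalIn⊤⇒maximal maxM))

  _⊆≪_≫ : Subset n → Subset n → Set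
  S ⊆≪ T ≫ = ∀ {x} → x ∈ S → _∈≪_≫ R x T

  ⊆⇒⊆≪≫ : ∀ {S T} → S ⊆ T → S ⊆≪ T ≫
  ⊆⇒⊆≪≫ S⊆T x∈S Q _ T⊆Q = T⊆Q (S⊆T x∈S)

  generated-mono : ∀ {S T x} → S ⊆≪ T ≫ → _∈≪_≫ R x S → _∈≪_≫ R x T
  generated-mono S⊆≪T≫ x∈≪S≫ Q subQ T⊆Q = x∈≪S≫ Q subQ λ s∈S → S⊆≪T≫ s∈S Q subQ T⊆Q

  ∪-⊆≪≫ : ∀ {A B T} → A ⊆≪ T ≫ → B ⊆≪ T ≫ → (A ∪ B) ⊆≪ T ≫
  ∪-⊆≪≫ {A} {B} A⊆ B⊆ x∈ with x∈p∪q⁻ A B x∈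
  ... | inj₁ x∈A = A⊆ x∈A
  ... | inj₂ x∈B = B⊆ x∈B

  maximal-generates : ∀ {Q M S x} → Closed Q → MaximalIn Q M → x ∈ Q → x ∉ M → x ∈ S →
                      Q ⊆≪ S ∪ M ≫
  maximal-generates {Q} {M} closedQ ((_ , M⊆Q , _) , maxM) x∈Q x∉M x∈S {y} y∈Q N subN S∪M⊆N
    with y ∈? N
  ... | yes y∈N = y∈N
  ... | no y∉N = ⊥-elim (x∉M (maxM (N ∩ Q) properN∩Q M⊆N∩Q (x∈p∩q⁺ (S∪M⊆N (x∈p∪q⁺ (inj₁ x∈S)) , x∈Q))))
    where
    M⊆N∩Q : M ⊆ N ∩ Q
    M⊆N∩Q m∈M = x∈p∩q⁺ (S∪M⊆N (x∈p∪q⁺ (inj₂ m∈M)) , M⊆Q m∈M)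
    properN∩Q : ProperSubrack Q (N ∩ Q)
    properN∩Q = ∩-closed (subrack⇒closed subN) closedQ
              , proj₂ ∘ x∈p∩q⁻ N Q , y , y∈Q , y∉N ∘ proj₁ ∘ x∈p∩q⁻ N Q

  ComplementIn : Subset n → Subset n → Subset n → Set
  ComplementIn Q₁ Q₂ Q = Closed Q × Q ⊆ Q₂ × (∀ x → x ∈ Q₁ → x ∈ Q → ⊥) × Q₂ ⊆≪ Q₁ ∪ Q ≫

  shrink : ∀ {Q₁ Q₂} Q → Acc _⊂_ Q → Closed Q → Q ⊆ Q₂ → Q₂ ⊆≪ Q₁ ∪ Q ≫ →
           Σ (Subset n) (ComplementIn Q₁ Q₂)
  shrink {Q₁} Q (acc smaller) closedQ Q⊆Q₂ Q₂⊆≪Q₁∪Q≫ with any? (λ x → (x ∈? Q₁) ×-dec (x ∈? Q))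
  ... | no disjoint = Q , closedQ , Q⊆Q₂ , (λ x x∈Q₁ x∈Q → disjoint (x , x∈Q₁ , x∈Q)) , Q₂⊆≪Q₁∪Q≫
  ... | yes (x , x∈Q₁ , x∈Q) with avoiding-maximal closedQ x∈Q
  ...   | M , maxM@((closedM , M⊆Q , _) , _) , x∉M =
    shrink M (smaller (M⊆Q , x , x∈Q , x∉M)) closedM (Q⊆Q₂ ∘ M⊆Q)
      (generated-mono Q₁∪Q⊆≪Q₁∪M≫ ∘ Q₂⊆≪Q₁∪Q≫)
    where
    Q₁∪Q⊆≪Q₁∪M≫ : (Q₁ ∪ Q) ⊆≪ Q₁ ∪ M ≫
    Q₁∪Q⊆≪Q₁∪M≫ = ∪-⊆≪≫ (⊆⇒⊆≪≫ (x∈p∪q⁺ ∘ inj₁)) (maximal-generates closedQ maxM x∈Q x∉M x∈Q₁)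

  complement-inside : ∀ Q₁ Q₂ → Closed Q₂ → Σ (Subset n) (ComplementIn Q₁ Q₂)
  complement-inside Q₁ Q₂ closedQ₂ =
    shrink Q₂ (⊂-wellFounded Q₂) closedQ₂ (λ y∈Q₂ → y∈Q₂) (⊆⇒⊆≪≫ (x∈p∪q⁺ ∘ inj₂))

  same-generated : ∀ {Q₁ Q₂ Q} → Q ⊆ Q₂ → Q₂ ⊆≪ Q₁ ∪ Q ≫ →
                   ∀ x → (_∈≪_≫ R x (Q₁ ∪ Q) → _∈≪_≫ R x (Q₁ ∪ Q₂)) ×
                         (_∈≪_≫ R x (Q₁ ∪ Q₂) → _∈≪_≫ R x (Q₁ ∪ Q))
  same-generated {Q₁} {Q₂} {Q} Q⊆Q₂ Q₂⊆≪Q₁∪Q≫ x =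
    generated-mono (∪-⊆≪≫ Q₁⊆≪Q₁∪Q₂≫ (⊆⇒⊆≪≫ (x∈p∪q⁺ ∘ inj₂ ∘ Q⊆Q₂))) ,
    generated-mono (∪-⊆≪≫ Q₁⊆≪Q₁∪Q≫ Q₂⊆≪Q₁∪Q≫)
    where
    Q₁⊆≪Q₁∪Q₂≫ : Q₁ ⊆≪ Q₁ ∪ Q₂ ≫
    Q₁⊆≪Q₁∪Q₂≫ = ⊆⇒⊆≪≫ (x∈p∪q⁺ ∘ inj₁)
    Q₁⊆≪Q₁∪Q≫ : Q₁ ⊆≪ Q₁ ∪ Q ≫
    Q₁⊆≪Q₁∪Q≫ = ⊆⇒⊆≪≫ (x∈p∪q⁺ ∘ inj₁)

theorem3p1 : ∀ {n : ℕ} (R : Rack n) →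
    (∀ (x : Fin n) → ¬ (_∈⋂Max R x)) ×
    (∀ (Q₁ Q₂ : Subset n) → IsSubrack R Q₁ → IsSubrack R Q₂ →
      Σ (Subset n) λ Q → IsSubrack R Q × Q ⊆ Q₂ ×
        (∀ x → x ∈ Q₁ → x ∈ Q → ⊥) ×
        (∀ x → (_∈≪_≫ R x (Q₁ ∪ Q) → _∈≪_≫ R x (Q₁ ∪ Q₂)) ×
               (_∈≪_≫ R x (Q₁ ∪ Q₂) → _∈≪_≫ R x (Q₁ ∪ Q))))
theorem3p1 R = ⋂maximal-empty , λ Q₁ Q₂ _ subQ₂ →
  let (Q , closedQ , Q⊆Q₂ , disjoint , Q₂⊆≪Q₁∪Q≫) = complement-inside Q₁ Q₂ (subrack⇒closed subQ₂)
  in Q , closed⇒subrack closedQ , (λ {z} → Q⊆Q₂ {z}) , disjoint , same-generated Q⊆Q₂ Q₂⊆≪Q₁∪Q≫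
  where open RackTheory R
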